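{- Let $q$ be a prime power, let $t \ge 1$, and let $f(x)=\sum_{i=0}^{t} b_i x^i \in \mathbb{F}_q[x]$ be a monic polynomial of degree $t$ with non-zero constant term $b_0 \neq 0$. Let $\Gamma_f=\{\beta_1,\ldots,\beta_\gamma\}$ be the set of $\beta\in\mathbb{F}_q$ with $f(\beta)\neq 0$ (so $\gamma=|\Gamma_f|$). Then the matrix $M(f)$ constructed from $f$ (as described in the context) is an $OOA(q^t;t,\gamma+1,t,q)$, i.e. a $q^t\times (\gamma+1)t$ array over $\mathbb{F}_q$, with columns partitioned into the $\gamma+1$ blocks $Bl(\infty), Bl(\beta_1),\ldots,Bl(\beta_\gamma)$ of $t$ columns each, in which every left-justified set of $t$ columns is covered.
   Context: Streams: $G(f)$ denotes the set of sequences $\mathbf{s}=(\mathbf{s}_n)_{n\in\mathbb{Z}}$ over $\mathbb{F}_q$ satisfying $\sum_{i=0}^{t} b_i \mathbf{s}_{n+i}=0$ for all $n\in\mathbb{Z}$ (since $b_0\ne0$ the recurrence can be run backwards, each stream is determined by $(\mathbf{s}_0,\ldots,\mathbf{s}_{t-1})\in\mathbb{F}_q^t$, so $|G(f)|=q^t$, and every stream is periodic). $L$ is the left-shift operator, $(L\mathbf{s})_n=\mathbf{s}_{n+1}$; for $g\in\mathbb{F}_q[x]$, $g(L)$ acts on $G(f)$ in the obvious way (using scalar multiplication $(\beta\mathbf{s})_n=\beta\mathbf{s}_n$ and addition). For $\beta\in\Gamma_f$ there is $g\in\mathbb{F}_q[x]$ with $g(x)(x-\beta)\equiv 1 \pmod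 f$, and $(L-\beta)^{ -1}:=g(L)$ is a well-defined map on $G(f)$ inverse to $L-\beta$. Construction of $M(f)$: The orbits of $L$ (sets $\{\mathbf{s},L\mathbf{s},\ldots,L^{\rho-1}\mathbf{s}\}$ with $\rho$ the period of $\mathbf{s}$) partition $G(f)$ into orbits $C_1,\ldots,C_k$; all streams in $C_i$ have the same period $\rho_i$ (so $\sum_i \rho_i=q^t$). For each $i$ choose a stream $\mathbf{a}^{(i)}\in C_i$ (the base). For $\beta\in\Gamma_f$, let $M(i,\beta)$ be the $\rho_i\times t$ matrix whose $j$-th column ($1\le j\le t$) consists of the entries with indices $0,1,\ldots,\rho_i-1$ of the stream $(L-\beta)^{ -j}\mathbf{a}^{(i)}$. Let $M(i,\infty)$ be the $\rho_i\times t$ matrix whose $j$-th column consists of the entries with indices $0,\ldots,\rho_i-1$ of $L^{j-1}\mathbf{a}^{(i)}$. $M(f)$ is the block matrix whose $i$-th block row ($1\le i\le k$) is $[\,M(i,\infty)\mid M(i,\beta_1)\mid\cdots\mid M(i,\beta_\gamma)\,]$; the block $Bl(\infty)$ consists of the $t$ columns coming from the $M(i,\infty)$, and $Bl(\beta_m)$ of the $t$ columns coming from the $M(i,\beta_m)$, with columns inside each block ordered by $j=1,\ldots,t$. OOA: an $n\times ms$ array over an alphabet of size $v$, with columns labeled $(i,j)$, $1\le i\le m$ (block), $1\le j\le s$ (position in block). A set $\Omega$ of columns is left-justified if $(i,j)\in\Omega$ with $j>1$ implies $(i,j-1)\in\Omega$. A set of $t$ columns is covered if every $t$-tuple over the alphabet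 appears exactly once as a row of the corresponding subarray. An $OOA(n;t,m,s,v)$ (with $n=v^t$) is such an array in which every left-justified set of $t$ columns is covered. -}

module Defs where

open import Level using (0ℓ)
open import Data.Nat as ℕ using (ℕ; zero; suc; _≤_; _<_)
open import Data.Integer as ℤ using (ℤ; +_)
open import Data.Fin using (Fin; zero; suc; toℕ)
open import Data.Bool using (Bool; true; false; if_then_else_)
open import Data.List using (List; filter; map; length; lookup; allFin)
open import Data.Product using (Σ; ∃; _×_; _,_; proj₁; proj₂)
open import Function.Bundles using (_↔_)
open import Relation.Nullary using (¬_)
open import Relation.Nullary.Decidable using (¬?)
open import Relation.Binary.Definitions using (DecidableEquality)
open import Relation.Binary.PropositionalEquality using (_≡_; _≢_)
open import Algebra.Structures using (IsCommutativeRing)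

-- A finite field of order q (q = size) with
-- propositional equality.  (Every finite field has prime-power order and
-- every prime power q is the order of a field, so quantifying over all
-- such records is quantifying over all F_q, q a prime power.)

record FiniteField : Set₁ where
  infixl 6 _+_
  infixl 7 _*_
  field
    Carrier : Set
    _+_ _*_ : Carrier → Carrier → Carrier
    -_      : Carrier → Carrier
    0# 1#   : Carrier
    isCommutativeRing : IsCommutativeRing {0ℓ} {0ℓ} _≡_ _+_ _*_ -_ 0# 1#
    0≢1     : 0# ≢ 1#
    inverse : ∀ x → x ≢ 0# → Σ Carrier (λ y → x * y ≡ 1#)
    _≟_     : DecidableEquality Carrier
    size    : ℕ
    enum    : Fin size ↔ Carrier

module _ (F : FiniteField) where
  open FiniteField F

  sumF : (n : ℕ) → (Fin n → Carrier) → Carrier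
  sumF zero    g = 0#
  sumF (suc n) g = g zero + sumF n (λ i → g (suc i))

  pow : Carrier → ℕ → Carrier
  pow x zero    = 1#
  pow x (suc n) = x * pow x n

  Poly : ℕ → Set
  Poly t = Fin (suc t) → Carrier

  eval : {t : ℕ} → Poly t → Carrier → Carrier
  eval {t} b x = sumF (suc t) (λ i → b i * pow x (toℕ i))

  Stream : Set
  Stream = ℤ → Carrier

  L : Stream → Stream
  L s n = s (n ℤ.+ + 1)

  Lpow : ℕ → Stream → Stream
  Lpow r s n = s (n ℤ.+ + r)

  _≈_ : Stream → Stream → Set
  s ≈ u = ∀ n → s n ≡ u n

  InG : {t : ℕ} → Poly t → Stream → Set
  InG {t} b s = ∀ n → sumF (suc t) (λ i → b i * s (n ℤ.+ + toℕ i)) ≡ 0#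

  IsPeriod : Stream → ℕ → Set
  IsPeriod s ρ = 1 ≤ ρ × (Lpow ρ s ≈ s)
               × (∀ r → 1 ≤ r → r < ρ → ¬ (Lpow r s ≈ s))

  Γ : {t : ℕ} → Poly t → List Carrier
  Γ b = filter (λ β → ¬? (eval b β ≟ 0#))
               (map (Function.Bundles.Inverse.to enum) (allFin size))

  γ : {t : ℕ} → Poly t → ℕ
  γ b = length (Γ b)

  βof : {t : ℕ} (b : Poly t) → Fin (γ b) → Carrier
  βof b m = lookup (Γ b) m

  -- (L - β)^{-1}: a map on G(f) inverse to L - β, i.e. for s ∈ G(f),
  -- inv s ∈ G(f) and (L - β)(inv s) = s.  (Unique, since L - β is a
  -- bijection of G(f) when f(β) ≠ 0.)
  IsInvLminus : {t : ℕ} → Poly t → Carrier → (Stream → Stream) → Set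
  IsInvLminus b β inv = ∀ s → InG b s →
    InG b (inv s) × (∀ n → inv s (n ℤ.+ + 1) + - (β * inv s n) ≡ s n)

  iter : ℕ → (Stream → Stream) → Stream → Stream
  iter zero    h s = s
  iter (suc n) h s = h (iter n h s)

  -- Orbit data: k orbits C_1..C_k with bases a^{(i)} of periods ρ_i;
  -- C_i = { L^r a^{(i)} : 0 ≤ r < ρ_i }, and these partition G(f).
  Row : (k : ℕ) → (Fin k → ℕ) → Set
  Row k ρ = Σ (Fin k) (λ i → Fin (ρ i))

  IsOrbitDecomposition : {t : ℕ} → Poly t →
    (k : ℕ) (ρ : Fin k → ℕ) (a : Fin k → Stream) → Set
  IsOrbitDecomposition b k ρ a =
    (∀ i → InG b (a i)) × (∀ i → IsPeriod (a i) (ρ i)) ×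
    (∀ s → InG b s →
       Σ (Row k ρ) (λ x → (s ≈ Lpow (toℕ (proj₂ x)) (a (proj₁ x))) ×
         (∀ y → s ≈ Lpow (toℕ (proj₂ y)) (a (proj₁ y)) → y ≡ x)))

  -- Rows are indexed by (i, r), 0 ≤ r < ρ_i (block row i);
  -- columns by (block, j) with block 0 = Bl(∞), block suc m = Bl(β_{m+1}),
  -- and j : Fin t standing for the column index j+1 ∈ {1..t}.
  M : {t : ℕ} (b : Poly t) (k : ℕ) (ρ : Fin k → ℕ) (a : Fin k → Stream)
      (inv : Fin (γ b) → Stream → Stream) →
      Row k ρ → Fin (suc (γ b)) → Fin t → Carrier
  M b k ρ a inv (i , r) zero    j = Lpow (toℕ j) (a i) (+ toℕ r)
  M b k ρ a inv (i , r) (suc m) j = iter (suc (toℕ j)) (inv m) (a i) (+ toℕ r)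

sumℕ : (n : ℕ) → (Fin n → ℕ) → ℕ
sumℕ zero    g = 0
sumℕ (suc n) g = g zero ℕ.+ sumℕ n (λ i → g (suc i))

ColSet : ℕ → ℕ → Set
ColSet m s = Fin m → Fin s → Bool

card : {m s : ℕ} → ColSet m s → ℕ
card {m} {s} Ω = sumℕ m (λ i → sumℕ s (λ j → if Ω i j then 1 else 0))

LeftJustified : {m s : ℕ} → ColSet m s → Set
LeftJustified {m} {s} Ω = ∀ i (j j' : Fin s) → suc (toℕ j') ≡ toℕ j →
  Ω i j ≡ true → Ω i j' ≡ true

Covered : {R X : Set} {m s : ℕ} → (R → Fin m → Fin s → X) → ColSet m s → Set
Covered {R} {X} {m} {s} A Ω = ∀ (v : Fin m → Fin s → X) →
  Σ R (λ x → (∀ i j → Ω i j ≡ true → A x i j ≡ v i j) ×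
    (∀ y → (∀ i j → Ω i j ≡ true → A y i j ≡ v i j) → y ≡ x))

-- A is an OOA(n; t, m, s, v) with rows indexed by Σ_{i<k} Fin (ρ i):
-- it has n rows, and every left-justified set of t columns is covered.
-- (The alphabet is the carrier of the field, of size v = q.)
IsOOA : {X : Set} (k : ℕ) (ρ : Fin k → ℕ) (n t m s : ℕ) →
        (Σ (Fin k) (λ i → Fin (ρ i)) → Fin m → Fin s → X) → Set
IsOOA k ρ n t m s A = sumℕ k ρ ≡ n ×
  (∀ (Ω : ColSet m s) → LeftJustified Ω → card Ω ≡ t → Covered A Ω)

-- By the orbit decomposition, rows of M(f) correspond to streams s of G(f),
-- and row s has entry s_{j-1} in column (∞, j) and ((L - β_m)^{-j} s)_0 in
-- column (β_m, j).  A left-justified set of t columns thus prescribes the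
-- first a values of s and the first c_m values ((L-β_m)^{-e} s)_0, with
-- a + Σ c_m = t.  The key lemma (§9, `conditions-determine`) says such
-- conditions have exactly one solution in G(f); it is proved by induction
-- on Σ c_m: if c_m > 0, s satisfies them iff u = (L-β_m)^{-1} s satisfies
-- conditions with one more initial value (partial fractions, §7, relate
-- the different β's), and t initial values determine a stream (§5).
-- Coverage follows, and the bijection rows ↔ initial windows F^t counts q^t rows.

module Submission where

open import Defs
open import Data.Nat using (ℕ; suc; _≤_; _^_)
open import Data.Fin using (Fin; zero; fromℕ)
open import Relation.Binary.PropositionalEquality using (_≡_; _≢_)

open import Level using (0ℓ)
open import Data.Bool using (Bool; true; false; if_then_else_)
open import Data.Empty using (⊥-elim)
open import Data.Maybe using (Maybe; just; nothing)
open import Data.Product using (Σ; _×_; _,_; proj₁; proj₂)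
open import Data.Sum using (_⊎_; inj₁; inj₂)
open import Relation.Nullary using (Dec; yes; no)
open import Relation.Nullary.Decidable using (¬?)
open import Relation.Binary.PropositionalEquality
  using (refl; sym; trans; cong; cong₂; subst; module ≡-Reasoning)

open import Data.Nat as ℕ using (zero; _<_; z≤n; s≤s)
import Data.Nat.Properties as ℕP
open import Data.Nat.DivMod using (_mod_; m<n⇒m%n≡m)
open import Data.Nat.GeneralisedArithmetic using (fold)
open import Data.Integer as ℤ using (ℤ; -[1+_]; _⊖_)
import Data.Integer.Properties as ℤP
open import Data.Fin as Fin using (suc; toℕ; inject₁)
import Data.Fin.Properties as FinP

open import Data.List as List using (List; _∷_)
import Data.List.Relation.Unary.All as All
import Data.List.Relation.Unary.All.Properties as AllP
open import Data.List.Relation.Unary.AllPairs using (_∷_)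
open import Data.List.Relation.Unary.Unique.Propositional using (Unique)
import Data.List.Relation.Unary.Unique.Propositional.Properties as UniqueP
open import Data.List.Membership.Propositional.Properties using (∈-lookup)
open import Data.Vec as Vec using (Vec; []; _∷_)
import Data.Vec.Properties as VecP
open import Data.Vec.Functional using (updateAt)
open import Data.Vec.Functional.Properties using (updateAt-updates; updateAt-minimal)

open import Function.Bundles using (Injection; Inverse; _↔_; mk↔ₛ′)
open import Function.Properties.Inverse using (↔⇒↣)
open import Function.Construct.Composition using (_↔-∘_)
open import Function.Construct.Symmetry using (↔-sym)
open import Function.Construct.Identity using (↔-id)
open import Data.Sum.Function.Propositional using (_⊎-↔_)
open import Data.Product.Function.NonDependent.Propositional using (_×-↔_)

open import Algebra.Bundles using (CommutativeRing)
open import Algebra.Solver.Ring.AlmostCommutativeRing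
  using (AlmostCommutativeRing; fromCommutativeRing; _-Raw-AlmostCommutative⟶_)

-- 1. Ring normalisation in a finite field.
--
-- Algebra.Solver.Ring needs a coefficient ring mapping homomorphically
-- into the field.  The integers serve, via the canonical map
-- ⟦ n ⟧ = n · 1; with ℤ coefficients identities such as x - x = 0
-- normalise by computation.

module FieldAlgebra (F : FiniteField) where
  open FiniteField F public
  open ≡-Reasoning

  commutativeRing : CommutativeRing 0ℓ 0ℓ
  commutativeRing = record { isCommutativeRing = isCommutativeRing }

  open CommutativeRing commutativeRing public
    using ( +-assoc; +-comm; *-assoc; *-comm; +-identityˡ; +-identityʳ
          ; *-identityˡ; distribʳ; -‿inverseʳ; zeroˡ; zeroʳ; ring; semiring )
  open import Algebra.Properties.Ring ring
    using (-‿involutive; -‿distribˡ-*; -‿distribʳ-*; -0#≈0#; -‿anti-homo-+; -‿injective; +-cancelˡ)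
  open import Algebra.Properties.Semiring.Mult.TCOptimised semiring
    using (1+×; ×-homo-+; ×1-homo-*) renaming (_×_ to _×ₙ_)

  ⟦_⟧ : ℤ → Carrier
  ⟦ ℤ.+ n ⟧    = n ×ₙ 1#
  ⟦ -[1+ n ] ⟧ = - (suc n ×ₙ 1#)

  -- (1 + x) - (1 + y) = x - y, proved by hand since the solver is built
  -- on top of this homomorphism
  cancel-one : ∀ x y → (1# + x) + - (1# + y) ≡ x + - y
  cancel-one x y = begin
    (1# + x) + - (1# + y)    ≡⟨ cong ((1# + x) +_) (-‿anti-homo-+ 1# y) ⟩
    (1# + x) + (- y + - 1#)  ≡⟨ +-assoc 1# x _ ⟩
    1# + (x + (- y + - 1#))  ≡⟨ cong (1# +_) (sym (+-assoc x _ _)) ⟩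
    1# + ((x + - y) + - 1#)  ≡⟨ +-comm 1# _ ⟩
    ((x + - y) + - 1#) + 1#  ≡⟨ +-assoc _ _ _ ⟩
    (x + - y) + (- 1# + 1#)  ≡⟨ cong ((x + - y) +_) (-‿inverseˡ 1#) ⟩
    (x + - y) + 0#           ≡⟨ +-identityʳ _ ⟩
    x + - y                  ∎
    where open CommutativeRing commutativeRing using (-‿inverseˡ)

  ⟦⊖⟧ : ∀ m n → ⟦ m ⊖ n ⟧ ≡ m ×ₙ 1# + - (n ×ₙ 1#)
  ⟦⊖⟧ zero    zero    = sym (trans (cong (0# +_) -0#≈0#) (+-identityˡ _))
  ⟦⊖⟧ zero    (suc n) = sym (+-identityˡ _)
  ⟦⊖⟧ (suc m) zero    = sym (trans (cong (suc m ×ₙ 1# +_) -0#≈0#) (+-identityʳ _))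
  ⟦⊖⟧ (suc m) (suc n) = begin
    ⟦ suc m ⊖ suc n ⟧                  ≡⟨ cong ⟦_⟧ (ℤP.[1+m]⊖[1+n]≡m⊖n m n) ⟩
    ⟦ m ⊖ n ⟧                          ≡⟨ ⟦⊖⟧ m n ⟩
    m ×ₙ 1# + - (n ×ₙ 1#)              ≡⟨ sym (cancel-one _ _) ⟩
    (1# + m ×ₙ 1#) + - (1# + n ×ₙ 1#)  ≡⟨ sym (cong₂ (λ x y → x + - y) (1+× m 1#) (1+× n 1#)) ⟩
    suc m ×ₙ 1# + - (suc n ×ₙ 1#)      ∎

  ⟦⟧-+ : ∀ i j → ⟦ i ℤ.+ j ⟧ ≡ ⟦ i ⟧ + ⟦ j ⟧
  ⟦⟧-+ (ℤ.+ m)  (ℤ.+ n)  = ×-homo-+ 1# m n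
  ⟦⟧-+ (ℤ.+ m)  -[1+ n ] = ⟦⊖⟧ m (suc n)
  ⟦⟧-+ -[1+ m ] (ℤ.+ n)  = trans (⟦⊖⟧ n (suc m)) (+-comm _ _)
  ⟦⟧-+ -[1+ m ] -[1+ n ] = begin
    - (suc (suc (m ℕ.+ n)) ×ₙ 1#)      ≡⟨ cong (λ k → - (suc k ×ₙ 1#)) (sym (ℕP.+-suc m n)) ⟩
    - ((suc m ℕ.+ suc n) ×ₙ 1#)        ≡⟨ cong -_ (×-homo-+ 1# (suc m) (suc n)) ⟩
    - (suc m ×ₙ 1# + suc n ×ₙ 1#)      ≡⟨ -‿anti-homo-+ _ _ ⟩
    - (suc n ×ₙ 1#) + - (suc m ×ₙ 1#)  ≡⟨ +-comm _ _ ⟩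
    - (suc m ×ₙ 1#) + - (suc n ×ₙ 1#)  ∎

  ⟦⟧-neg : ∀ i → ⟦ ℤ.- i ⟧ ≡ - ⟦ i ⟧
  ⟦⟧-neg (ℤ.+ zero)  = sym -0#≈0#
  ⟦⟧-neg (ℤ.+ suc n) = refl
  ⟦⟧-neg -[1+ n ]    = sym (-‿involutive _)

  ⟦⟧-*⁺ : ∀ m j → ⟦ ℤ.+ m ℤ.* j ⟧ ≡ ⟦ ℤ.+ m ⟧ * ⟦ j ⟧
  ⟦⟧-*⁺ m (ℤ.+ n)  = trans (cong ⟦_⟧ (sym (ℤP.pos-* m n))) (×1-homo-* m n)
  ⟦⟧-*⁺ m -[1+ n ] = begin
    ⟦ ℤ.+ m ℤ.* -[1+ n ] ⟧         ≡⟨ cong ⟦_⟧ (sym (ℤP.neg-distribʳ-* (ℤ.+ m) (ℤ.+ suc n))) ⟩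
    ⟦ ℤ.- (ℤ.+ m ℤ.* ℤ.+ suc n) ⟧  ≡⟨ ⟦⟧-neg (ℤ.+ m ℤ.* ℤ.+ suc n) ⟩
    - ⟦ ℤ.+ m ℤ.* ℤ.+ suc n ⟧      ≡⟨ cong -_ (⟦⟧-*⁺ m (ℤ.+ suc n)) ⟩
    - (m ×ₙ 1# * (suc n ×ₙ 1#))    ≡⟨ -‿distribʳ-* _ _ ⟩
    m ×ₙ 1# * - (suc n ×ₙ 1#)      ∎

  ⟦⟧-* : ∀ i j → ⟦ i ℤ.* j ⟧ ≡ ⟦ i ⟧ * ⟦ j ⟧
  ⟦⟧-* (ℤ.+ m)  j = ⟦⟧-*⁺ m j
  ⟦⟧-* -[1+ m ] j = begin
    ⟦ -[1+ m ] ℤ.* j ⟧             ≡⟨ cong ⟦_⟧ (sym (ℤP.neg-distribˡ-* (ℤ.+ suc m) j)) ⟩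
    ⟦ ℤ.- (ℤ.+ suc m ℤ.* j) ⟧      ≡⟨ ⟦⟧-neg (ℤ.+ suc m ℤ.* j) ⟩
    - ⟦ ℤ.+ suc m ℤ.* j ⟧          ≡⟨ cong -_ (⟦⟧-*⁺ (suc m) j) ⟩
    - (⟦ ℤ.+ suc m ⟧ * ⟦ j ⟧)      ≡⟨ -‿distribˡ-* _ _ ⟩
    ⟦ -[1+ m ] ⟧ * ⟦ j ⟧           ∎

  almostCommutativeRing : AlmostCommutativeRing 0ℓ 0ℓ
  almostCommutativeRing = fromCommutativeRing commutativeRing

  integerCoefficients : ℤ.+-*-rawRing -Raw-AlmostCommutative⟶ almostCommutativeRing
  integerCoefficients = record
    { ⟦_⟧ = ⟦_⟧ ; +-homo = ⟦⟧-+ ; *-homo = ⟦⟧-* ; -‿homo = ⟦⟧-neg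
    ; 0-homo = refl ; 1-homo = refl }

  ⟦⟧-decide : ∀ i j → Maybe (⟦ i ⟧ ≡ ⟦ j ⟧)
  ⟦⟧-decide i j with i ℤ.≟ j
  ... | yes i≡j = just (cong ⟦_⟧ i≡j)
  ... | no  _   = nothing

  open import Algebra.Solver.Ring ℤ.+-*-rawRing almostCommutativeRing integerCoefficients ⟦⟧-decide
    public using (solve; _:=_; _:+_; _:*_; :-_; con)

  *-cancelˡ-nonzero : ∀ x y y′ → x ≢ 0# → x * y ≡ x * y′ → y ≡ y′
  *-cancelˡ-nonzero x y y′ x≢0 xy≡xy′ with inverse x x≢0
  ... | x⁻¹ , xx⁻¹≡1 = begin
    y                 ≡⟨ undo y ⟩
    x⁻¹ * (x * y)     ≡⟨ cong (x⁻¹ *_) xy≡xy′ ⟩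
    x⁻¹ * (x * y′)    ≡⟨ sym (undo y′) ⟩
    y′                ∎
    where
    undo : ∀ z → z ≡ x⁻¹ * (x * z)
    undo z = begin
      z                ≡⟨ sym (*-identityˡ z) ⟩
      1# * z           ≡⟨ cong (_* z) (sym xx⁻¹≡1) ⟩
      (x * x⁻¹) * z    ≡⟨ solve 3 (λ x x⁻¹ z → (x :* x⁻¹) :* z := x⁻¹ :* (x :* z))
                                  refl x x⁻¹ z ⟩
      x⁻¹ * (x * z)    ∎

  cancel-nonzero : ∀ x y → x ≢ 0# → x * y ≡ 0# → y ≡ 0#
  cancel-nonzero x y x≢0 xy≡0 = *-cancelˡ-nonzero x y 0# x≢0 (trans xy≡0 (sym (zeroʳ x)))

  -‿cancel : ∀ p y y′ → p + - y ≡ p + - y′ → y ≡ y′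
  -‿cancel p y y′ eq = -‿injective (+-cancelˡ p (- y) (- y′) eq)

  *-distrib-minus : ∀ k x y → k * x + - k * y ≡ k * (x + - y)
  *-distrib-minus = solve 3 (λ k x y → k :* x :+ :- k :* y := k :* (x :+ :- y)) refl

-- 2. Finite sums in the field

module FiniteSums (F : FiniteField) where
  open FieldAlgebra F
  open ≡-Reasoning

  sum-cong : ∀ n {g h : Fin n → Carrier} → (∀ i → g i ≡ h i) → sumF F n g ≡ sumF F n h
  sum-cong zero    g≡h = refl
  sum-cong (suc n) g≡h = cong₂ _+_ (g≡h zero) (sum-cong n (λ i → g≡h (suc i)))

  sum-zero : ∀ n (g : Fin n → Carrier) → (∀ i → g i ≡ 0#) → sumF F n g ≡ 0#
  sum-zero zero    g g≡0 = refl
  sum-zero (suc n) g g≡0 =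
    trans (cong₂ _+_ (g≡0 zero) (sum-zero n _ (λ i → g≡0 (suc i)))) (+-identityˡ 0#)

  sum-linear : ∀ n α δ (g h : Fin n → Carrier) →
    sumF F n (λ i → α * g i + δ * h i) ≡ α * sumF F n g + δ * sumF F n h
  sum-linear zero    α δ g h =
    solve 2 (λ α δ → con (ℤ.+ 0) := α :* con (ℤ.+ 0) :+ δ :* con (ℤ.+ 0)) refl α δ
  sum-linear (suc n) α δ g h = begin
    (α * g zero + δ * h zero) + sumF F n (λ i → α * g (suc i) + δ * h (suc i))
      ≡⟨ cong ((α * g zero + δ * h zero) +_) (sum-linear n α δ (λ i → g (suc i)) (λ i → h (suc i))) ⟩
    (α * g zero + δ * h zero) + (α * G′ + δ * H′)
      ≡⟨ solve 6 (λ α δ a b c d → (α :* a :+ δ :* b) :+ (α :* c :+ δ :* d)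
                                  := α :* (a :+ c) :+ δ :* (b :+ d))
               refl α δ (g zero) (h zero) G′ H′ ⟩
    α * (g zero + G′) + δ * (h zero + H′) ∎
    where
    G′ H′ : Carrier
    G′ = sumF F n (λ i → g (suc i))
    H′ = sumF F n (λ i → h (suc i))

  sum-*ʳ : ∀ n (g : Fin n → Carrier) y → sumF F n (λ i → g i * y) ≡ sumF F n g * y
  sum-*ʳ zero    g y = sym (zeroˡ y)
  sum-*ʳ (suc n) g y = trans (cong (g zero * y +_) (sum-*ʳ n (λ i → g (suc i)) y)) (sym (distribʳ y _ _))

  sum-last : ∀ n (g : Fin (suc n) → Carrier) →
    sumF F (suc n) g ≡ sumF F n (λ i → g (inject₁ i)) + g (fromℕ n)
  sum-last zero    g = +-comm (g zero) 0#
  sum-last (suc n) g = begin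
    g zero + sumF F (suc n) (λ i → g (suc i))
      ≡⟨ cong (g zero +_) (sum-last n (λ i → g (suc i))) ⟩
    g zero + (sumF F n (λ i → g (suc (inject₁ i))) + g (suc (fromℕ n)))
      ≡⟨ sym (+-assoc _ _ _) ⟩
    (g zero + sumF F n (λ i → g (suc (inject₁ i)))) + g (suc (fromℕ n)) ∎

-- 3. Index arithmetic on ℤ: regrouping the positions n + i of a stream

ι : ℕ → ℤ
ι = ℤ.+_

+-suc-right : ∀ n k → n ℤ.+ ι (suc k) ≡ (n ℤ.+ ι k) ℤ.+ ι 1
+-suc-right n k = begin
  n ℤ.+ ι (suc k)        ≡⟨ cong (λ z → n ℤ.+ ι z) (ℕP.+-comm 1 k) ⟩
  n ℤ.+ ι (k ℕ.+ 1)      ≡⟨ cong (λ z → n ℤ.+ z) (ℤP.pos-+ k 1) ⟩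
  n ℤ.+ (ι k ℤ.+ ι 1)    ≡⟨ sym (ℤP.+-assoc n _ _) ⟩
  (n ℤ.+ ι k) ℤ.+ ι 1    ∎
  where open ≡-Reasoning

+-suc-left : ∀ n k → n ℤ.+ ι (suc k) ≡ (n ℤ.+ ι 1) ℤ.+ ι k
+-suc-left n k = trans (cong (λ z → n ℤ.+ z) (ℤP.pos-+ 1 k)) (sym (ℤP.+-assoc n _ _))

ι-suc : ∀ i → ι (suc i) ≡ ι i ℤ.+ ι 1
ι-suc = +-suc-right (ι 0)

+-swap : ∀ n x y → (n ℤ.+ x) ℤ.+ y ≡ (n ℤ.+ y) ℤ.+ x
+-swap n x y =
  trans (ℤP.+-assoc n x y) (trans (cong (λ z → n ℤ.+ z) (ℤP.+-comm x y)) (sym (ℤP.+-assoc n y x)))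

-- 4. The space G(f) of streams satisfying the recurrence of f

module LinearRecurrence (F : FiniteField) {t : ℕ} (b : Poly F t) where
  open FieldAlgebra F
  open FiniteSums F
  open ≡-Reasoning

  G : Stream F → Set
  G = InG F b

  linComb : Carrier → Stream F → Carrier → Stream F → Stream F
  linComb α X δ Y n = α * X n + δ * Y n

  difference : Stream F → Stream F → Stream F
  difference X Y = linComb 1# X (- 1#) Y

  difference-zero⇒≈ : ∀ X Y → (∀ n → difference X Y n ≡ 0#) → _≈_ F X Y
  difference-zero⇒≈ X Y d≡0 n = begin
    X n                     ≡⟨ solve 2 (λ x y → x := (con (ℤ.+ 1) :* x :+ :- con (ℤ.+ 1) :* y) :+ y)
                                     refl (X n) (Y n) ⟩
    difference X Y n + Y n  ≡⟨ cong (_+ Y n) (d≡0 n) ⟩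
    0# + Y n                ≡⟨ +-identityˡ _ ⟩
    Y n                     ∎

  difference-self : ∀ x → 1# * x + - 1# * x ≡ 0#
  difference-self = solve 1 (λ x → con (ℤ.+ 1) :* x :+ :- con (ℤ.+ 1) :* x := con (ℤ.+ 0)) refl

  G-cong : ∀ {X Y} → _≈_ F X Y → G X → G Y
  G-cong {X} {Y} X≈Y X∈G n =
    trans (sum-cong (suc t) (λ i → cong (b i *_) (sym (X≈Y (n ℤ.+ ι (toℕ i)))))) (X∈G n)

  G-linComb : ∀ α X δ Y → G X → G Y → G (linComb α X δ Y)
  G-linComb α X δ Y X∈G Y∈G n = begin
    sumF F (suc t) (λ i → b i * (α * X (n+ i) + δ * Y (n+ i)))
      ≡⟨ sum-cong (suc t) (λ i → solve 5 (λ b α x δ y → b :* (α :* x :+ δ :* y)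
                                                        := α :* (b :* x) :+ δ :* (b :* y))
                                          refl (b i) α (X (n+ i)) δ (Y (n+ i))) ⟩
    sumF F (suc t) (λ i → α * (b i * X (n+ i)) + δ * (b i * Y (n+ i)))
      ≡⟨ sum-linear (suc t) α δ (λ i → b i * X (n+ i)) (λ i → b i * Y (n+ i)) ⟩
    α * sumF F (suc t) (λ i → b i * X (n+ i)) + δ * sumF F (suc t) (λ i → b i * Y (n+ i))
      ≡⟨ cong₂ (λ p q → α * p + δ * q) (X∈G n) (Y∈G n) ⟩
    α * 0# + δ * 0#
      ≡⟨ solve 2 (λ α δ → α :* con (ℤ.+ 0) :+ δ :* con (ℤ.+ 0) := con (ℤ.+ 0)) refl α δ ⟩
    0# ∎
    where
    n+ : Fin (suc t) → ℤ
    n+ i = n ℤ.+ ι (toℕ i)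

  G-shift : ∀ r X → G X → G (Lpow F r X)
  G-shift r X X∈G n =
    trans (sum-cong (suc t) (λ i → cong (λ z → b i * X z) (+-swap n (ι (toℕ i)) (ι r))))
          (X∈G (n ℤ.+ ι r))

  L-β : Carrier → Stream F → Stream F
  L-β β Y n = Y (n ℤ.+ ι 1) + - (β * Y n)

  L-β-linComb : ∀ β α X δ Y n → L-β β (linComb α X δ Y) n ≡ α * L-β β X n + δ * L-β β Y n
  L-β-linComb β α X δ Y n =
    solve 7 (λ β α x₁ x₀ δ y₁ y₀ → (α :* x₁ :+ δ :* y₁) :+ :- (β :* (α :* x₀ :+ δ :* y₀))
                                  := α :* (x₁ :+ :- (β :* x₀)) :+ δ :* (y₁ :+ :- (β :* y₀)))
      refl β α (X (n ℤ.+ ι 1)) (X n) δ (Y (n ℤ.+ ι 1)) (Y n)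

  G-L-β : ∀ β Y → G Y → G (L-β β Y)
  G-L-β β Y Y∈G = G-cong as-linComb (G-linComb 1# (Lpow F 1 Y) (- β) Y (G-shift 1 Y Y∈G) Y∈G)
    where
    as-linComb : _≈_ F (linComb 1# (Lpow F 1 Y) (- β) Y) (L-β β Y)
    as-linComb n = solve 3 (λ y₁ β y₀ → con (ℤ.+ 1) :* y₁ :+ :- β :* y₀ := y₁ :+ :- (β :* y₀))
                     refl (Y (n ℤ.+ ι 1)) β (Y n)

  rise : ∀ β Y n → Y (n ℤ.+ ι 1) ≡ L-β β Y n + β * Y n
  rise β Y n = solve 2 (λ y₁ βy → y₁ := (y₁ :+ :- βy) :+ βy) refl (Y (n ℤ.+ ι 1)) (β * Y n)

  -- L - β is injective on G(f) when f(β) ≠ 0: a stream of G(f) killed by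
  -- L - β is geometric, Y_{n+k} = β^k Y_n, so the recurrence gives f(β) Y_n = 0.
  L-β-kernel : ∀ β Y → eval F b β ≢ 0# → G Y → (∀ n → L-β β Y n ≡ 0#) → ∀ n → Y n ≡ 0#
  L-β-kernel β Y fβ≢0 Y∈G ΔY≡0 n = cancel-nonzero (eval F b β) (Y n) fβ≢0 (begin
    eval F b β * Y n
      ≡⟨ sym (sum-*ʳ (suc t) (λ i → b i * pow F β (toℕ i)) (Y n)) ⟩
    sumF F (suc t) (λ i → (b i * pow F β (toℕ i)) * Y n)
      ≡⟨ sum-cong (suc t) (λ i → trans (*-assoc _ _ _) (cong (b i *_) (sym (geometric (toℕ i))))) ⟩
    sumF F (suc t) (λ i → b i * Y (n ℤ.+ ι (toℕ i)))
      ≡⟨ Y∈G n ⟩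
    0# ∎)
    where
    step : ∀ m → Y (m ℤ.+ ι 1) ≡ β * Y m
    step m = begin
      Y (m ℤ.+ ι 1)                  ≡⟨ rise β Y m ⟩
      L-β β Y m + β * Y m            ≡⟨ cong (_+ β * Y m) (ΔY≡0 m) ⟩
      0# + β * Y m                   ≡⟨ +-identityˡ _ ⟩
      β * Y m                        ∎
    geometric : ∀ k → Y (n ℤ.+ ι k) ≡ pow F β k * Y n
    geometric zero    = trans (cong Y (ℤP.+-identityʳ n)) (sym (*-identityˡ _))
    geometric (suc k) = begin
      Y (n ℤ.+ ι (suc k))            ≡⟨ cong Y (+-suc-right n k) ⟩
      Y ((n ℤ.+ ι k) ℤ.+ ι 1)        ≡⟨ step _ ⟩
      β * Y (n ℤ.+ ι k)              ≡⟨ cong (β *_) (geometric k) ⟩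
      β * (pow F β k * Y n)          ≡⟨ sym (*-assoc _ _ _) ⟩
      (β * pow F β k) * Y n          ∎

-- 5. For monic f with f(0) ≠ 0, a stream of G(f) is freely and uniquely
--    determined by its t initial values s_0, …, s_{t-1}.

module MonicRecurrence (F : FiniteField) (t′ : ℕ) (b : Poly F (suc t′))
  (monic : b (fromℕ (suc t′)) ≡ FiniteField.1# F) (b₀≢0 : b zero ≢ FiniteField.0# F) where
  open FieldAlgebra F
  open FiniteSums F
  open LinearRecurrence F b
  open ≡-Reasoning

  t : ℕ
  t = suc t′

  recurrence-split : ∀ (s : Stream F) n →
    sumF F (suc t) (λ i → b i * s (n ℤ.+ ι (toℕ i)))
      ≡ sumF F t (λ j → b (inject₁ j) * s (n ℤ.+ ι (toℕ j))) + s (n ℤ.+ ι t)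
  recurrence-split s n = trans (sum-last t g) (cong₂ _+_ lower top)
    where
    g : Fin (suc t) → Carrier
    g i = b i * s (n ℤ.+ ι (toℕ i))
    lower : sumF F t (λ j → g (inject₁ j)) ≡ sumF F t (λ j → b (inject₁ j) * s (n ℤ.+ ι (toℕ j)))
    lower = sum-cong t (λ j → cong (λ k → b (inject₁ j) * s (n ℤ.+ ι k)) (FinP.toℕ-inject₁ j))
    top : g (fromℕ t) ≡ s (n ℤ.+ ι t)
    top = trans (cong₂ (λ p k → p * s (n ℤ.+ ι k)) monic (FinP.toℕ-fromℕ t)) (*-identityˡ _)

  VanishesFrom : Stream F → ℤ → Set
  VanishesFrom d n = ∀ i → i < t → d (n ℤ.+ ι i) ≡ 0#

  lower-vanishes : ∀ d n (c : Fin t → Carrier) → VanishesFrom d n →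
    sumF F t (λ j → c j * d (n ℤ.+ ι (toℕ j))) ≡ 0#
  lower-vanishes d n c d≡0 =
    sum-zero t _ (λ j → trans (cong (c j *_) (d≡0 (toℕ j) (FinP.toℕ<n j))) (zeroʳ _))

  -- the window slides forward (solve the recurrence for its top term) …
  vanish-forward : ∀ d → G d → ∀ n → VanishesFrom d n → VanishesFrom d (n ℤ.+ ι 1)
  vanish-forward d d∈G n d≡0 i i<t with suc i ℕ.<? t
  ... | yes 1+i<t = trans (cong d (sym (+-suc-left n i))) (d≡0 (suc i) 1+i<t)
  ... | no  1+i≮t = begin
    d ((n ℤ.+ ι 1) ℤ.+ ι i)    ≡⟨ cong (λ k → d ((n ℤ.+ ι 1) ℤ.+ ι k)) i≡t′ ⟩
    d ((n ℤ.+ ι 1) ℤ.+ ι t′)   ≡⟨ cong d (sym (+-suc-left n t′)) ⟩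
    d (n ℤ.+ ι t)              ≡⟨ sym (+-identityˡ _) ⟩
    0# + d (n ℤ.+ ι t)         ≡⟨ cong (_+ d (n ℤ.+ ι t))
                                       (sym (lower-vanishes d n (λ j → b (inject₁ j)) d≡0)) ⟩
    sumF F t (λ j → b (inject₁ j) * d (n ℤ.+ ι (toℕ j))) + d (n ℤ.+ ι t)
                               ≡⟨ sym (recurrence-split d n) ⟩
    sumF F (suc t) (λ i → b i * d (n ℤ.+ ι (toℕ i)))
                               ≡⟨ d∈G n ⟩
    0#                         ∎
    where
    i≡t′ : i ≡ t′
    i≡t′ = ℕP.≤-antisym (ℕP.≤-pred i<t) (ℕP.≤-pred (ℕP.≤-pred (ℕP.≰⇒> 1+i≮t)))

  -- … and backward (solve the recurrence for its bottom term, b₀ ≠ 0)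
  vanish-backward : ∀ d → G d → ∀ m → VanishesFrom d (m ℤ.+ ι 1) → VanishesFrom d m
  vanish-backward d d∈G m d≡0 zero    _   = cancel-nonzero (b zero) _ b₀≢0 (begin
    b zero * d (m ℤ.+ ι 0)         ≡⟨ sym (+-identityʳ _) ⟩
    b zero * d (m ℤ.+ ι 0) + 0#    ≡⟨ cong (b zero * d (m ℤ.+ ι 0) +_) (sym upper) ⟩
    sumF F (suc t) (λ i → b i * d (m ℤ.+ ι (toℕ i)))
                                   ≡⟨ d∈G m ⟩
    0#                             ∎)
    where
    upper : sumF F t (λ j → b (suc j) * d (m ℤ.+ ι (suc (toℕ j)))) ≡ 0#
    upper = trans (sum-cong t (λ j → cong (λ z → b (suc j) * d z) (+-suc-left m (toℕ j))))
                  (lower-vanishes d (m ℤ.+ ι 1) (λ j → b (suc j)) d≡0)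
  vanish-backward d d∈G m d≡0 (suc i) 1+i<t =
    trans (cong d (+-suc-left m i)) (d≡0 i (ℕP.<-trans (ℕP.n<1+n i) 1+i<t))

  vanish-everywhere : ∀ d → G d → VanishesFrom d (ι 0) → ∀ z → VanishesFrom d z
  vanish-everywhere d d∈G d≡0 (ℤ.+ n) = from-ι n
    where
    from-ι : ∀ n → VanishesFrom d (ι n)
    from-ι zero    = d≡0
    from-ι (suc n) =
      subst (VanishesFrom d) (cong ι (ℕP.+-comm n 1)) (vanish-forward d d∈G (ι n) (from-ι n))
  vanish-everywhere d d∈G d≡0 -[1+ n ] = from-neg n
    where
    from-neg : ∀ n → VanishesFrom d -[1+ n ]
    from-neg zero    = vanish-backward d d∈G -[1+ 0 ] d≡0
    from-neg (suc n) = vanish-backward d d∈G -[1+ suc n ] (from-neg n)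

  ≈-from-initial : ∀ s s′ → G s → G s′ → (∀ i → i < t → s (ι i) ≡ s′ (ι i)) → _≈_ F s s′
  ≈-from-initial s s′ s∈G s′∈G s≡s′ = difference-zero⇒≈ s s′ (λ n →
    trans (cong (difference s s′) (sym (ℤP.+-identityʳ n)))
          (vanish-everywhere (difference s s′) d∈G initial n 0 (s≤s z≤n)))
    where
    d∈G : G (difference s s′)
    d∈G = G-linComb 1# s (- 1#) s′ s∈G s′∈G
    initial : VanishesFrom (difference s s′) (ι 0)
    initial i i<t =
      trans (cong (λ y → 1# * s (ι i) + - 1# * y) (sym (s≡s′ i i<t))) (difference-self (s (ι i)))

  -- A window w : ℕ → F stands for the t consecutive values
  -- w 0, …, w (t-1); `advance` and `retreat` slide it along the recurrence,
  -- and the extension of v takes at z ∈ ℤ the first value of the window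
  -- obtained from v by z slides.
  Window : Set
  Window = ℕ → Carrier

  _≗ₜ_ : Window → Window → Set
  w ≗ₜ w′ = ∀ i → i < t → w i ≡ w′ i

  forcedNext : Window → Carrier
  forcedNext w = - sumF F t (λ j → b (inject₁ j) * w (toℕ j))

  advance : Window → Window
  advance w i with i ℕ.≟ t′
  ... | yes _ = forcedNext w
  ... | no  _ = w (suc i)

  advance-last : ∀ w → advance w t′ ≡ forcedNext w
  advance-last w with t′ ℕ.≟ t′
  ... | yes _    = refl
  ... | no  t′≢t′ = ⊥-elim (t′≢t′ refl)

  advance-init : ∀ w i → i ≢ t′ → advance w i ≡ w (suc i)
  advance-init w i i≢t′ with i ℕ.≟ t′
  ... | yes i≡t′ = ⊥-elim (i≢t′ i≡t′)
  ... | no  _    = refl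

  b₀⁻¹ : Carrier
  b₀⁻¹ = proj₁ (inverse (b zero) b₀≢0)

  forcedPrev : Window → Carrier
  forcedPrev w = b₀⁻¹ * - sumF F t (λ j → b (suc j) * w (toℕ j))

  retreat : Window → Window
  retreat w zero    = forcedPrev w
  retreat w (suc i) = w i

  advance-retreat : ∀ w → advance (retreat w) ≗ₜ w
  advance-retreat w i i<t with i ℕ.≟ t′
  ... | no  _    = refl
  ... | yes refl = begin
    - (b zero * forcedPrev w + A)
      ≡⟨ cong (λ z → - (b zero * (b₀⁻¹ * - z) + A)) split ⟩
    - (b zero * (b₀⁻¹ * - (A + w t′)) + A)
      ≡⟨ solve 4 (λ b₀ b₀⁻¹ a w → :- (b₀ :* (b₀⁻¹ :* :- (a :+ w)) :+ a)
                                  := (b₀ :* b₀⁻¹) :* (a :+ w) :+ :- a)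
               refl (b zero) b₀⁻¹ A (w t′) ⟩
    (b zero * b₀⁻¹) * (A + w t′) + - A
      ≡⟨ cong (λ z → z * (A + w t′) + - A) (proj₂ (inverse (b zero) b₀≢0)) ⟩
    1# * (A + w t′) + - A
      ≡⟨ solve 2 (λ a w → con (ℤ.+ 1) :* (a :+ w) :+ :- a := w) refl A (w t′) ⟩
    w t′ ∎
    where
    A : Carrier
    A = sumF F t′ (λ j → b (suc (inject₁ j)) * w (toℕ j))
    split : sumF F t (λ j → b (suc j) * w (toℕ j)) ≡ A + w t′
    split = trans (sum-last t′ (λ j → b (suc j) * w (toℕ j)))
      (cong₂ _+_ (sum-cong t′ (λ j → cong (λ k → b (suc (inject₁ j)) * w k) (FinP.toℕ-inject₁ j)))
                 (trans (cong₂ (λ p k → p * w k) monic (FinP.toℕ-fromℕ t′)) (*-identityˡ _)))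

  module Extension (v : Window) where
    state : ℤ → Window
    state (ℤ.+ n)  = fold v advance n
    state -[1+ n ] = fold v retreat (suc n)

    state-step : ∀ z → state (z ℤ.+ ι 1) ≗ₜ advance (state z)
    state-step (ℤ.+ n)       i _   = cong (λ k → fold v advance k i) (ℕP.+-comm n 1)
    state-step -[1+ zero ]   i i<t = sym (advance-retreat v i i<t)
    state-step -[1+ suc n ]  i i<t = sym (advance-retreat (state -[1+ n ]) i i<t)

    extend : Stream F
    extend z = state z 0

    extend-window : ∀ i z → i < t → extend (z ℤ.+ ι i) ≡ state z i
    extend-window zero    z _     = cong (λ y → state y 0) (ℤP.+-identityʳ z)
    extend-window (suc i) z 1+i<t = begin
      extend (z ℤ.+ ι (suc i))          ≡⟨ cong extend (+-suc-left z i) ⟩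
      extend ((z ℤ.+ ι 1) ℤ.+ ι i)      ≡⟨ extend-window i (z ℤ.+ ι 1) i<t ⟩
      state (z ℤ.+ ι 1) i               ≡⟨ state-step z i i<t ⟩
      advance (state z) i               ≡⟨ advance-init (state z) i i≢t′ ⟩
      state z (suc i)                   ∎
      where
      i<t : i < t
      i<t = ℕP.<-trans (ℕP.n<1+n i) 1+i<t
      i≢t′ : i ≢ t′
      i≢t′ i≡t′ = ℕP.<-irrefl i≡t′ (ℕP.≤-pred 1+i<t)

    extend-top : ∀ z → extend (z ℤ.+ ι t) ≡ forcedNext (state z)
    extend-top z = begin
      extend (z ℤ.+ ι t)                ≡⟨ cong extend (+-suc-left z t′) ⟩
      extend ((z ℤ.+ ι 1) ℤ.+ ι t′)     ≡⟨ extend-window t′ (z ℤ.+ ι 1) (ℕP.n<1+n t′) ⟩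
      state (z ℤ.+ ι 1) t′              ≡⟨ state-step z t′ (ℕP.n<1+n t′) ⟩
      advance (state z) t′              ≡⟨ advance-last (state z) ⟩
      forcedNext (state z)              ∎

    extend-G : G extend
    extend-G z = begin
      sumF F (suc t) (λ i → b i * extend (z ℤ.+ ι (toℕ i)))
        ≡⟨ recurrence-split extend z ⟩
      sumF F t (λ j → b (inject₁ j) * extend (z ℤ.+ ι (toℕ j))) + extend (z ℤ.+ ι t)
        ≡⟨ cong₂ _+_ lower (extend-top z) ⟩
      A + - A                           ≡⟨ -‿inverseʳ A ⟩
      0#                                ∎
      where
      A : Carrier
      A = sumF F t (λ j → b (inject₁ j) * state z (toℕ j))
      lower : sumF F t (λ j → b (inject₁ j) * extend (z ℤ.+ ι (toℕ j))) ≡ A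
      lower = sum-cong t (λ j → cong (b (inject₁ j) *_) (extend-window (toℕ j) z (FinP.toℕ<n j)))

    extend-initial : ∀ i → i < t → extend (ι i) ≡ v i
    extend-initial i i<t = extend-window i (ι 0) i<t

-- 6. The non-roots β_1, …, β_γ of f are distinct and satisfy f(β_m) ≠ 0

unique-lookup-injective : ∀ {A : Set} (xs : List A) → Unique xs →
  ∀ i j → List.lookup xs i ≡ List.lookup xs j → i ≡ j
unique-lookup-injective (x ∷ xs) _          zero    zero    _  = refl
unique-lookup-injective (x ∷ xs) (x∉ ∷ _)   zero    (suc j) eq =
  ⊥-elim (All.lookup x∉ (∈-lookup j) eq)
unique-lookup-injective (x ∷ xs) (x∉ ∷ _)   (suc i) zero    eq =
  ⊥-elim (All.lookup x∉ (∈-lookup i) (sym eq))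
unique-lookup-injective (x ∷ xs) (_ ∷ uniq) (suc i) (suc j) eq =
  cong suc (unique-lookup-injective xs uniq i j eq)

module NonRoots (F : FiniteField) {t : ℕ} (b : Poly F t) where
  open FiniteField F

  βof-nonroot : ∀ m → eval F b (βof F b m) ≢ 0#
  βof-nonroot m = All.lookup (AllP.all-filter (λ β → ¬? (eval F b β ≟ 0#)) elements) (∈-lookup m)
    where
    elements : List Carrier
    elements = List.map (Inverse.to enum) (List.allFin size)

  βof-injective : ∀ m m′ → βof F b m ≡ βof F b m′ → m ≡ m′
  -- Γ f is a sublist of the duplicate-free enumeration of F
  βof-injective = unique-lookup-injective (Γ F b)
    (UniqueP.filter⁺ _ (UniqueP.map⁺ (Injection.injective (↔⇒↣ enum)) (UniqueP.allFin⁺ size)))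

-- 7. The inverse operators (L - β_m)^{-1} on G(f)

module InverseShifts (F : FiniteField) {t : ℕ} (b : Poly F t)
  (inv : Fin (γ F b) → Stream F → Stream F)
  (inv-spec : ∀ m → IsInvLminus F b (βof F b m) (inv m)) where
  open FieldAlgebra F
  open LinearRecurrence F b
  open NonRoots F b
  open ≡-Reasoning

  β : Fin (γ F b) → Carrier
  β = βof F b

  inv-G : ∀ m s → G s → G (inv m s)
  inv-G m s s∈G = proj₁ (inv-spec m s s∈G)

  inv-right : ∀ m s → G s → ∀ n → L-β (β m) (inv m s) n ≡ s n
  inv-right m s s∈G = proj₂ (inv-spec m s s∈G)

  inv-unique : ∀ m X Y → G X → G Y → (∀ n → L-β (β m) Y n ≡ X n) → _≈_ F (inv m X) Y
  inv-unique m X Y X∈G Y∈G ΔY≡X = difference-zero⇒≈ (inv m X) Y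
    (L-β-kernel (β m) (difference (inv m X) Y) (βof-nonroot m)
      (G-linComb 1# (inv m X) (- 1#) Y (inv-G m X X∈G) Y∈G)
      (λ n → begin
        L-β (β m) (difference (inv m X) Y) n
          ≡⟨ L-β-linComb (β m) 1# (inv m X) (- 1#) Y n ⟩
        1# * L-β (β m) (inv m X) n + - 1# * L-β (β m) Y n
          ≡⟨ cong₂ (λ p q → 1# * p + - 1# * q) (inv-right m X X∈G n) (ΔY≡X n) ⟩
        1# * X n + - 1# * X n
          ≡⟨ difference-self (X n) ⟩
        0# ∎))

  inv-cong : ∀ m X X′ → G X → G X′ → _≈_ F X X′ → _≈_ F (inv m X) (inv m X′)
  inv-cong m X X′ X∈G X′∈G X≈X′ = inv-unique m X (inv m X′) X∈G (inv-G m X′ X′∈G)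
    (λ n → trans (inv-right m X′ X′∈G n) (sym (X≈X′ n)))

  inv-shift : ∀ m r X → G X → _≈_ F (inv m (Lpow F r X)) (Lpow F r (inv m X))
  inv-shift m r X X∈G = inv-unique m (Lpow F r X) (Lpow F r (inv m X))
    (G-shift r X X∈G) (G-shift r (inv m X) (inv-G m X X∈G))
    (λ n → trans (cong (λ z → inv m X z + - (β m * inv m X (n ℤ.+ ι r))) (+-swap n (ι 1) (ι r)))
                 (inv-right m X X∈G (n ℤ.+ ι r)))

  invPow : Fin (γ F b) → ℕ → Stream F → Stream F
  invPow m e = iter F e (inv m)

  invPow-G : ∀ m e s → G s → G (invPow m e s)
  invPow-G m zero    s s∈G = s∈G
  invPow-G m (suc e) s s∈G = inv-G m (invPow m e s) (invPow-G m e s s∈G)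

  invPow-cong : ∀ m e X X′ → G X → G X′ → _≈_ F X X′ → _≈_ F (invPow m e X) (invPow m e X′)
  invPow-cong m zero    X X′ X∈G X′∈G X≈X′ = X≈X′
  invPow-cong m (suc e) X X′ X∈G X′∈G X≈X′ =
    inv-cong m (invPow m e X) (invPow m e X′) (invPow-G m e X X∈G) (invPow-G m e X′ X′∈G)
      (invPow-cong m e X X′ X∈G X′∈G X≈X′)

  invPow-suc : ∀ m e s → invPow m e (inv m s) ≡ invPow m (suc e) s
  invPow-suc m zero    s = refl
  invPow-suc m (suc e) s = cong (inv m) (invPow-suc m e s)

  invPow-shift : ∀ m e r X → G X → _≈_ F (invPow m e (Lpow F r X)) (Lpow F r (invPow m e X))
  invPow-shift m zero    r X X∈G n = refl
  invPow-shift m (suc e) r X X∈G n = trans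
    (inv-cong m (invPow m e (Lpow F r X)) (Lpow F r (invPow m e X))
       (invPow-G m e (Lpow F r X) (G-shift r X X∈G))
       (G-shift r (invPow m e X) (invPow-G m e X X∈G))
       (invPow-shift m e r X X∈G) n)
    (inv-shift m r (invPow m e X) (invPow-G m e X X∈G) n)

  -- Partial fractions.  For β_m ≠ β_m′ and κ = (β_m - β_m′)^{-1},
  --   (L-β_m′)^{-(e+1)} (L-β_m)^{-1} = κ (L-β_m′)^{-e} (L-β_m)^{-1} - κ (L-β_m′)^{-(e+1)}.
  module PartialFractions (m m′ : Fin (γ F b)) (m′≢m : m′ ≢ m) where
    gap : Carrier
    gap = β m + - β m′

    gap≢0 : gap ≢ 0#
    gap≢0 gap≡0 = m′≢m (βof-injective m′ m (sym (begin
      β m                 ≡⟨ solve 2 (λ x y → x := (x :+ :- y) :+ y) refl (β m) (β m′) ⟩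
      gap + β m′          ≡⟨ cong (_+ β m′) gap≡0 ⟩
      0# + β m′           ≡⟨ +-identityˡ _ ⟩
      β m′                ∎)))

    κ : Carrier
    κ = proj₁ (inverse gap gap≢0)

    κ*gap : κ * gap ≡ 1#
    κ*gap = trans (*-comm κ gap) (proj₂ (inverse gap gap≢0))

    κ≢0 : κ ≢ 0#
    κ≢0 κ≡0 = 0≢1 (begin
      0#            ≡⟨ sym (zeroˡ gap) ⟩
      0# * gap      ≡⟨ cong (_* gap) (sym κ≡0) ⟩
      κ * gap       ≡⟨ κ*gap ⟩
      1#            ∎)

    partial-fraction₁ : ∀ s → G s →
      _≈_ F (inv m′ (inv m s)) (linComb κ (inv m s) (- κ) (inv m′ s))
    partial-fraction₁ s s∈G = inv-unique m′ u Y (inv-G m s s∈G)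
      (G-linComb κ u (- κ) (inv m′ s) (inv-G m s s∈G) (inv-G m′ s s∈G)) ΔY≡u
      where
      u Y : Stream F
      u = inv m s
      Y = linComb κ u (- κ) (inv m′ s)
      ΔY≡u : ∀ n → L-β (β m′) Y n ≡ u n
      ΔY≡u n = begin
        L-β (β m′) Y n
          ≡⟨ L-β-linComb (β m′) κ u (- κ) (inv m′ s) n ⟩
        κ * L-β (β m′) u n + - κ * L-β (β m′) (inv m′ s) n
          ≡⟨ cong (λ z → κ * L-β (β m′) u n + - κ * z) (inv-right m′ s s∈G n) ⟩
        κ * (u (n ℤ.+ ι 1) + - (β m′ * u n)) + - κ * s n
          ≡⟨ solve 6 (λ k x₁ x₀ b b′ s →
                        k :* (x₁ :+ :- (b′ :* x₀)) :+ :- k :* s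
                        := (k :* (b :+ :- b′)) :* x₀ :+ k :* ((x₁ :+ :- (b :* x₀)) :+ :- s))
                   refl κ (u (n ℤ.+ ι 1)) (u n) (β m) (β m′) (s n) ⟩
        (κ * gap) * u n + κ * (L-β (β m) u n + - s n)
          ≡⟨ cong₂ (λ p q → p * u n + κ * (q + - s n)) κ*gap (inv-right m s s∈G n) ⟩
        1# * u n + κ * (s n + - s n)
          ≡⟨ solve 3 (λ x k s → con (ℤ.+ 1) :* x :+ k :* (s :+ :- s) := x) refl (u n) κ (s n) ⟩
        u n ∎

    -- the general case follows by applying (L-β_m′)^{-1} to both sides
    partial-fraction : ∀ s → G s → ∀ e →
      _≈_ F (invPow m′ (suc e) (inv m s))
            (linComb κ (invPow m′ e (inv m s)) (- κ) (invPow m′ (suc e) s))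
    partial-fraction s s∈G zero    = partial-fraction₁ s s∈G
    partial-fraction s s∈G (suc e) = inv-unique m′ X Y X∈G
      (G-linComb κ X (- κ) (invPow m′ (suc (suc e)) s) X∈G (invPow-G m′ (suc (suc e)) s s∈G)) ΔY≡X
      where
      X Y : Stream F
      X = invPow m′ (suc e) (inv m s)
      Y = linComb κ X (- κ) (invPow m′ (suc (suc e)) s)
      X∈G : G X
      X∈G = invPow-G m′ (suc e) (inv m s) (inv-G m s s∈G)
      ΔY≡X : ∀ n → L-β (β m′) Y n ≡ X n
      ΔY≡X n = begin
        L-β (β m′) Y n
          ≡⟨ L-β-linComb (β m′) κ X (- κ) (invPow m′ (suc (suc e)) s) n ⟩
        κ * L-β (β m′) X n + - κ * L-β (β m′) (invPow m′ (suc (suc e)) s) n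
          ≡⟨ cong₂ (λ p q → κ * p + - κ * q)
                   (inv-right m′ (invPow m′ e (inv m s)) (invPow-G m′ e (inv m s) (inv-G m s s∈G)) n)
                   (inv-right m′ (invPow m′ (suc e) s) (invPow-G m′ (suc e) s s∈G) n) ⟩
        κ * invPow m′ e (inv m s) n + - κ * invPow m′ (suc e) s n
          ≡⟨ sym (partial-fraction s s∈G e n) ⟩
        X n ∎

    -- the recursion obeyed by the values ((L-β_m′)^{-(e+1)} (L-β_m)^{-1} s)_0,
    -- given x₀ = ((L-β_m)^{-1} s)_0 and y e = ((L-β_m′)^{-(e+1)} s)_0
    pfSeq : Carrier → (ℕ → Carrier) → ℕ → Carrier
    pfSeq x₀ y zero    = κ * (x₀ + - y 0)
    pfSeq x₀ y (suc e) = κ * (pfSeq x₀ y e + - y (suc e))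

    pfSeq-values : ∀ s → G s → ∀ e →
      invPow m′ (suc e) (inv m s) (ι 0) ≡ pfSeq (inv m s (ι 0)) (λ e → invPow m′ (suc e) s (ι 0)) e
    pfSeq-values s s∈G zero    =
      trans (partial-fraction s s∈G zero (ι 0)) (*-distrib-minus κ _ _)
    pfSeq-values s s∈G (suc e) =
      trans (partial-fraction s s∈G (suc e) (ι 0))
            (trans (cong (λ x → κ * x + - κ * invPow m′ (suc (suc e)) s (ι 0))
                         (pfSeq-values s s∈G e))
                   (*-distrib-minus κ _ _))

    pfSeq-agree : ∀ x₀ y y′ c → (∀ e → e < c → y e ≡ y′ e) →
      ∀ e → e < c → pfSeq x₀ y e ≡ pfSeq x₀ y′ e
    pfSeq-agree x₀ y y′ c y≡y′ zero    0<c   = cong (λ z → κ * (x₀ + - z)) (y≡y′ 0 0<c)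
    pfSeq-agree x₀ y y′ c y≡y′ (suc e) 1+e<c =
      cong₂ (λ q z → κ * (q + - z)) (pfSeq-agree x₀ y y′ c y≡y′ e (ℕP.<-trans (ℕP.n<1+n e) 1+e<c))
                                   (y≡y′ (suc e) 1+e<c)

    κ-step-injective : ∀ p z z′ → κ * (p + - z) ≡ κ * (p + - z′) → z ≡ z′
    κ-step-injective p z z′ eq = -‿cancel p z z′ (*-cancelˡ-nonzero κ _ _ κ≢0 eq)

    pfSeq-reflect : ∀ x₀ y y′ c → (∀ e → e < c → pfSeq x₀ y e ≡ pfSeq x₀ y′ e) →
      ∀ e → e < c → y e ≡ y′ e
    pfSeq-reflect x₀ y y′ c same zero    0<c   = κ-step-injective x₀ _ _ (same 0 0<c)
    pfSeq-reflect x₀ y y′ c same (suc e) 1+e<c = κ-step-injective (pfSeq x₀ y e) _ _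
      (trans (same (suc e) 1+e<c)
             (cong (λ q → κ * (q + - y′ (suc e))) (sym (same e (ℕP.<-trans (ℕP.n<1+n e) 1+e<c)))))

-- 8. Bookkeeping on the vectors of counts c : Fin γ → ℕ used in the induction

sum-zero⇒zero : ∀ {γ} (c : Fin γ → ℕ) → sumℕ γ c ≡ 0 → ∀ m → c m ≡ 0
sum-zero⇒zero {suc γ} c Σc≡0 zero    = ℕP.m+n≡0⇒m≡0 (c zero) Σc≡0
sum-zero⇒zero {suc γ} c Σc≡0 (suc m) =
  sum-zero⇒zero (λ j → c (suc j)) (ℕP.m+n≡0⇒n≡0 (c zero) Σc≡0) m

some-positive : ∀ {γ} (c : Fin γ → ℕ) n → sumℕ γ c ≡ suc n →
  Σ (Fin γ) λ m → Σ ℕ λ e → c m ≡ suc e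
some-positive {zero}  c n ()
some-positive {suc γ} c n Σc≡1+n with c zero in c₀≡
... | suc e = zero , e , c₀≡
... | zero with some-positive (λ j → c (suc j)) n Σc≡1+n
...   | m , e , cm≡1+e = suc m , e , cm≡1+e

sum-decrement : ∀ {γ} (c : Fin γ → ℕ) m e → c m ≡ suc e →
  sumℕ γ c ≡ suc (sumℕ γ (updateAt c m ℕ.pred))
sum-decrement {suc γ} c zero    e c₀≡1+e rewrite c₀≡1+e = refl
sum-decrement {suc γ} c (suc m) e cm≡1+e =
  trans (cong (c zero ℕ.+_) (sum-decrement (λ j → c (suc j)) m e cm≡1+e)) (ℕP.+-suc (c zero) _)

-- 9. The key lemma: conditions of the shape of a left-justified set of t
--    columns single out exactly one stream of G(f).

module Conditions (F : FiniteField) (t′ : ℕ) (b : Poly F (suc t′))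
  (monic : b (fromℕ (suc t′)) ≡ FiniteField.1# F) (b₀≢0 : b zero ≢ FiniteField.0# F)
  (inv : Fin (γ F b) → Stream F → Stream F)
  (inv-spec : ∀ m → IsInvLminus F b (βof F b m) (inv m)) where
  open FieldAlgebra F
  open LinearRecurrence F b
  open MonicRecurrence F t′ b monic b₀≢0
  open InverseShifts F b inv inv-spec
  open ≡-Reasoning

  Index : Set
  Index = Fin (γ F b)

  record Satisfies (a : ℕ) (c : Index → ℕ) (V∞ : ℕ → Carrier) (Vβ : Index → ℕ → Carrier)
                   (s : Stream F) : Set where
    field
      at∞ : ∀ i → i < a → s (ι i) ≡ V∞ i
      atβ : ∀ m e → e < c m → invPow m (suc e) s (ι 0) ≡ Vβ m e

  satisfies-≈ : ∀ {a c V∞ Vβ} s s′ → G s → G s′ → _≈_ F s s′ →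
    Satisfies a c V∞ Vβ s → Satisfies a c V∞ Vβ s′
  satisfies-≈ s s′ s∈G s′∈G s≈s′ sat = record
    { at∞ = λ i i<a → trans (sym (s≈s′ (ι i))) (at∞ i i<a)
    ; atβ = λ m e e<c → trans (sym (invPow-cong m (suc e) s s′ s∈G s′∈G s≈s′ (ι 0))) (atβ m e e<c) }
    where open Satisfies sat

  record UniqueSolution (P : Stream F → Set) : Set where
    field
      solution   : Stream F
      solution-G : G solution
      solves     : P solution
      unique     : ∀ s s′ → G s → G s′ → P s → P s′ → _≈_ F s s′

  initial-conditions : ∀ c V∞ Vβ → (∀ m → c m ≡ 0) → UniqueSolution (Satisfies t c V∞ Vβ)
  initial-conditions c V∞ Vβ c≡0 = record
    { solution   = extend
    ; solution-G = extend-G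
    ; solves     = record
        { at∞ = extend-initial
        ; atβ = λ m e e<cm → ⊥-elim (ℕP.n≮0 (subst (e <_) (c≡0 m) e<cm)) }
    ; unique     = λ s s′ s∈G s′∈G sat sat′ → ≈-from-initial s s′ s∈G s′∈G
                     (λ i i<t → trans (Satisfies.at∞ sat i i<t) (sym (Satisfies.at∞ sat′ i i<t))) }
    where open Extension V∞

  -- One condition at β_m (c m = e₀ + 1) trades for one more initial value:
  -- s satisfies (a, c, V∞, Vβ) iff u = (L - β_m)^{-1} s satisfies (a+1, c′, V∞′, Vβ′).
  module Reduction (m : Index) (e₀ a : ℕ) (c : Index → ℕ) (cm≡1+e₀ : c m ≡ suc e₀)
                   (V∞ : ℕ → Carrier) (Vβ : Index → ℕ → Carrier) where
    c′ : Index → ℕ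
    c′ = updateAt c m ℕ.pred

    c′m≡e₀ : c′ m ≡ e₀
    c′m≡e₀ = trans (updateAt-updates m c) (cong ℕ.pred cm≡1+e₀)

    e<c′m⇒1+e<cm : ∀ e → e < c′ m → suc e < c m
    e<c′m⇒1+e<cm e e<c′m = subst (suc e <_) (sym cm≡1+e₀) (s≤s (subst (e <_) c′m≡e₀ e<c′m))

    1+e<cm⇒e<c′m : ∀ e → suc e < c m → e < c′ m
    1+e<cm⇒e<c′m e 1+e<cm =
      subst (e <_) (sym c′m≡e₀) (ℕP.≤-pred (subst (suc (suc e) ≤_) cm≡1+e₀ 1+e<cm))

    c′-other : ∀ m″ → m″ ≢ m → c′ m″ ≡ c m″
    c′-other m″ m″≢m = updateAt-minimal m″ m c m″≢m

    0<cm : 0 < c m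
    0<cm = subst (0 <_) (sym cm≡1+e₀) (s≤s z≤n)

    -- u_0 = ((L-β_m)^{-1} s)_0 and u_{i+1} = s_i + β_m u_i
    V∞′ : ℕ → Carrier
    V∞′ zero    = Vβ m 0
    V∞′ (suc i) = V∞ i + β m * V∞′ i

    -- at β_m the remaining conditions of s move down by one; at β_m″ ≠ β_m
    -- they are transformed by the partial-fraction recursion.  (Defined by
    -- cases on a decision of m″ ≡ m, the same case split the proofs make.)
    Vβ′At : ∀ m″ → Dec (m″ ≡ m) → ℕ → Carrier
    Vβ′At m″ (yes _)    e = Vβ m (suc e)
    Vβ′At m″ (no m″≢m)    = PartialFractions.pfSeq m m″ m″≢m (Vβ m 0) (Vβ m″)

    Vβ′ : Index → ℕ → Carrier
    Vβ′ m″ = Vβ′At m″ (m″ Fin.≟ m)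

    module Forward (s : Stream F) (s∈G : G s) (sat : Satisfies a c V∞ Vβ s) where
      open Satisfies sat

      u : Stream F
      u = inv m s

      u-at∞ : ∀ i → i < suc a → u (ι i) ≡ V∞′ i
      u-at∞ zero    _     = atβ m 0 0<cm
      u-at∞ (suc i) 1+i<1+a = begin
        u (ι (suc i))                     ≡⟨ cong u (ι-suc i) ⟩
        u (ι i ℤ.+ ι 1)                   ≡⟨ rise (β m) u (ι i) ⟩
        L-β (β m) u (ι i) + β m * u (ι i) ≡⟨ cong₂ (λ p q → p + β m * q) (inv-right m s s∈G (ι i))
                                                   (u-at∞ i (ℕP.<-trans (ℕP.n<1+n i) 1+i<1+a)) ⟩
        s (ι i) + β m * V∞′ i             ≡⟨ cong (_+ β m * V∞′ i) (at∞ i (ℕP.≤-pred 1+i<1+a)) ⟩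
        V∞′ (suc i)                       ∎

      u-atβ : ∀ m″ (d : Dec (m″ ≡ m)) e → e < c′ m″ →
              invPow m″ (suc e) u (ι 0) ≡ Vβ′At m″ d e
      u-atβ m″ (yes refl) e e<c′m =
        trans (cong (λ X → X (ι 0)) (invPow-suc m (suc e) s)) (atβ m (suc e) (e<c′m⇒1+e<cm e e<c′m))
      u-atβ m″ (no m″≢m) e e<c′m″ = begin
        invPow m″ (suc e) u (ι 0)     ≡⟨ pfSeq-values s s∈G e ⟩
        pfSeq (u (ι 0)) s-values e    ≡⟨ cong (λ x₀ → pfSeq x₀ s-values e) (u-at∞ 0 (s≤s z≤n)) ⟩
        pfSeq (Vβ m 0) s-values e     ≡⟨ pfSeq-agree (Vβ m 0) s-values (Vβ m″) (c m″) (atβ m″) e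
                                                     (subst (e <_) (c′-other m″ m″≢m) e<c′m″) ⟩
        pfSeq (Vβ m 0) (Vβ m″) e      ∎
        where
        open PartialFractions m m″ m″≢m
        s-values : ℕ → Carrier
        s-values e = invPow m″ (suc e) s (ι 0)

      satisfies-inv : Satisfies (suc a) c′ V∞′ Vβ′ u
      satisfies-inv = record { at∞ = u-at∞ ; atβ = λ m″ → u-atβ m″ (m″ Fin.≟ m) }

    module Backward (u : Stream F) (u∈G : G u) (sat′ : Satisfies (suc a) c′ V∞′ Vβ′ u) where
      open Satisfies sat′

      s : Stream F
      s = L-β (β m) u

      s∈G : G s
      s∈G = G-L-β (β m) u u∈G

      inv-s≈u : _≈_ F (inv m s) u
      inv-s≈u = inv-unique m s u s∈G u∈G (λ n → refl)

      inv-s-at0 : inv m s (ι 0) ≡ Vβ m 0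
      inv-s-at0 = trans (inv-s≈u (ι 0)) (at∞ 0 (s≤s z≤n))

      s-at∞ : ∀ i → i < a → s (ι i) ≡ V∞ i
      s-at∞ i i<a = begin
        u (ι i ℤ.+ ι 1) + - (β m * u (ι i))
          ≡⟨ cong₂ (λ x y → x + - (β m * y)) (trans (cong u (sym (ι-suc i))) (at∞ (suc i) (s≤s i<a)))
                                             (at∞ i (ℕP.<-trans i<a (ℕP.n<1+n a))) ⟩
        (V∞ i + β m * V∞′ i) + - (β m * V∞′ i)
          ≡⟨ solve 2 (λ x y → (x :+ y) :+ :- y := x) refl (V∞ i) (β m * V∞′ i) ⟩
        V∞ i ∎

      s-atβ : ∀ m″ (d : Dec (m″ ≡ m)) →
              (∀ e → e < c′ m″ → invPow m″ (suc e) u (ι 0) ≡ Vβ′At m″ d e) →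
              ∀ e → e < c m″ → invPow m″ (suc e) s (ι 0) ≡ Vβ m″ e
      s-atβ m″ (yes refl) _ zero    _     = inv-s-at0
      s-atβ m″ (yes refl) u-atβ (suc e) 2+e<cm = begin
        invPow m (suc (suc e)) s (ι 0)    ≡⟨ cong (λ X → X (ι 0)) (sym (invPow-suc m (suc e) s)) ⟩
        invPow m (suc e) (inv m s) (ι 0)  ≡⟨ invPow-cong m (suc e) (inv m s) u (inv-G m s s∈G) u∈G
                                                          inv-s≈u (ι 0) ⟩
        invPow m (suc e) u (ι 0)          ≡⟨ u-atβ e (1+e<cm⇒e<c′m e 2+e<cm) ⟩
        Vβ m (suc e)                      ∎
      s-atβ m″ (no m″≢m) u-atβ = pfSeq-reflect (Vβ m 0) s-values (Vβ m″) (c m″) same-pfSeq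
        where
        open PartialFractions m m″ m″≢m
        s-values : ℕ → Carrier
        s-values e = invPow m″ (suc e) s (ι 0)
        same-pfSeq : ∀ e → e < c m″ → pfSeq (Vβ m 0) s-values e ≡ pfSeq (Vβ m 0) (Vβ m″) e
        same-pfSeq e e<cm″ = begin
          pfSeq (Vβ m 0) s-values e          ≡⟨ cong (λ x₀ → pfSeq x₀ s-values e) (sym inv-s-at0) ⟩
          pfSeq (inv m s (ι 0)) s-values e   ≡⟨ sym (pfSeq-values s s∈G e) ⟩
          invPow m″ (suc e) (inv m s) (ι 0)  ≡⟨ invPow-cong m″ (suc e) (inv m s) u (inv-G m s s∈G) u∈G
                                                           inv-s≈u (ι 0) ⟩
          invPow m″ (suc e) u (ι 0)          ≡⟨ u-atβ e (subst (e <_) (sym (c′-other m″ m″≢m))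
                                                                  e<cm″) ⟩
          pfSeq (Vβ m 0) (Vβ m″) e           ∎

      satisfies-L-β : Satisfies a c V∞ Vβ s
      satisfies-L-β = record { at∞ = s-at∞ ; atβ = λ m″ → s-atβ m″ (m″ Fin.≟ m) (atβ m″) }

    reduce : UniqueSolution (Satisfies (suc a) c′ V∞′ Vβ′) → UniqueSolution (Satisfies a c V∞ Vβ)
    reduce sol = record
      { solution   = Backward.s solution solution-G solves
      ; solution-G = Backward.s∈G solution solution-G solves
      ; solves     = Backward.satisfies-L-β solution solution-G solves
      ; unique     = unique-original }
      where
      open UniqueSolution sol
      -- s = (L-β_m) (L-β_m)^{-1} s, and (L-β_m)^{-1} s is pinned down by the reduced conditions
      unique-original : ∀ s s′ → G s → G s′ →
        Satisfies a c V∞ Vβ s → Satisfies a c V∞ Vβ s′ → _≈_ F s s′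
      unique-original s s′ s∈G s′∈G sat sat′ n = begin
        s n                     ≡⟨ sym (inv-right m s s∈G n) ⟩
        L-β (β m) (inv m s) n   ≡⟨ cong₂ (λ x y → x + - (β m * y))
                                         (inv-s≈inv-s′ (n ℤ.+ ι 1)) (inv-s≈inv-s′ n) ⟩
        L-β (β m) (inv m s′) n  ≡⟨ inv-right m s′ s′∈G n ⟩
        s′ n                    ∎
        where
        inv-s≈inv-s′ : _≈_ F (inv m s) (inv m s′)
        inv-s≈inv-s′ = unique (inv m s) (inv m s′) (inv-G m s s∈G) (inv-G m s′ s′∈G)
                         (Forward.satisfies-inv s s∈G sat) (Forward.satisfies-inv s′ s′∈G sat′)

  conditions-determine : ∀ n a c → sumℕ (γ F b) c ≡ n → a ℕ.+ n ≡ t → ∀ V∞ Vβ →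
    UniqueSolution (Satisfies a c V∞ Vβ)
  conditions-determine zero    a c Σc≡0 a+0≡t V∞ Vβ =
    subst (λ a → UniqueSolution (Satisfies a c V∞ Vβ)) (trans (sym a+0≡t) (ℕP.+-identityʳ a))
          (initial-conditions c V∞ Vβ (sum-zero⇒zero c Σc≡0))
  conditions-determine (suc n) a c Σc≡1+n a+1+n≡t V∞ Vβ with some-positive c n Σc≡1+n
  ... | m , e₀ , cm≡1+e₀ = reduce (conditions-determine n (suc a) c′ Σc′≡n 1+a+n≡t V∞′ Vβ′)
    where
    open Reduction m e₀ a c cm≡1+e₀ V∞ Vβ
    1+a+n≡t : suc a ℕ.+ n ≡ t
    1+a+n≡t = trans (sym (ℕP.+-suc a n)) a+1+n≡t
    Σc′≡n : sumℕ (γ F b) c′ ≡ n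
    Σc′≡n = ℕP.suc-injective (trans (sym (sum-decrement c m e₀ cm≡1+e₀)) Σc≡1+n)

-- 10. Left-justified sets of columns.  Within a block, a left-justified
--     set is a prefix {0, …, count - 1} of the block.

IsPrefix : ∀ {n} → (Fin n → Bool) → Set
IsPrefix {n} P = ∀ (j j′ : Fin n) → suc (toℕ j′) ≡ toℕ j → P j ≡ true → P j′ ≡ true

count : ∀ n → (Fin n → Bool) → ℕ
count n P = sumℕ n (λ j → if P j then 1 else 0)

count≤ : ∀ n P → count n P ≤ n
count≤ zero    P = z≤n
count≤ (suc n) P with P zero
... | true  = s≤s (count≤ n (λ j → P (suc j)))
... | false = ℕP.m≤n⇒m≤1+n (count≤ n (λ j → P (suc j)))

count-none : ∀ n (P : Fin n → Bool) → (∀ j → P j ≡ false) → count n P ≡ 0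
count-none zero    P P≡false = refl
count-none (suc n) P P≡false rewrite P≡false zero =
  count-none n (λ j → P (suc j)) (λ j → P≡false (suc j))

prefix-tail : ∀ {n} (P : Fin (suc n) → Bool) → IsPrefix P → IsPrefix (λ j → P (suc j))
prefix-tail P prefix j j′ 1+j′≡j = prefix (suc j) (suc j′) (cong suc 1+j′≡j)

prefix-head : ∀ {n} (P : Fin (suc n) → Bool) → IsPrefix P → ∀ k (j : Fin (suc n)) → toℕ j ≡ k →
  P j ≡ true → P zero ≡ true
prefix-head P prefix zero    zero    _   Pj = Pj
prefix-head P prefix (suc k) (suc j) j≡k Pj =
  prefix-head P prefix k (inject₁ j) (trans (FinP.toℕ-inject₁ j) (ℕP.suc-injective j≡k))
    (prefix (suc j) (inject₁ j) (cong suc (FinP.toℕ-inject₁ j)) Pj)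

true≢false : true ≢ false
true≢false ()

prefix-true⇒< : ∀ n (P : Fin n → Bool) → IsPrefix P → ∀ j → P j ≡ true → toℕ j < count n P
prefix-true⇒< (suc n) P prefix j Pj with P zero in P₀≡
prefix-true⇒< (suc n) P prefix zero    Pj | true  = s≤s z≤n
prefix-true⇒< (suc n) P prefix (suc j) Pj | true  =
  s≤s (prefix-true⇒< n (λ j → P (suc j)) (prefix-tail P prefix) j Pj)
... | false = ⊥-elim (true≢false (trans (sym (prefix-head P prefix (toℕ j) j refl Pj)) P₀≡))

prefix-<⇒true : ∀ n (P : Fin n → Bool) → IsPrefix P → ∀ j → toℕ j < count n P → P j ≡ true
prefix-<⇒true (suc n) P prefix j j<count with P zero in P₀≡
prefix-<⇒true (suc n) P prefix zero    _     | true = P₀≡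
prefix-<⇒true (suc n) P prefix (suc j) j<count | true =
  prefix-<⇒true n (λ j → P (suc j)) (prefix-tail P prefix) j (ℕP.≤-pred j<count)
... | false = ⊥-elim (ℕP.n≮0 (subst (toℕ j <_) (count-none n (λ j → P (suc j)) tail-false) j<count))
  where
  tail-false : ∀ j → P (suc j) ≡ false
  tail-false j with P (suc j) in P₁₊ⱼ≡
  ... | false = refl
  ... | true  =
    ⊥-elim (true≢false (trans (sym (prefix-head P prefix (suc (toℕ j)) (suc j) refl P₁₊ⱼ≡)) P₀≡))

-- 11. Cardinalities via explicit bijections

↔⇒≡ : ∀ {m n} → Fin m ↔ Fin n → m ≡ n
↔⇒≡ m↔n = FinP.cantor-schröder-bernstein (Injection.injective (↔⇒↣ m↔n))
                                           (Injection.injective (↔⇒↣ (↔-sym m↔n)))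

sum↔Σ : ∀ k (ρ : Fin k → ℕ) → Fin (sumℕ k ρ) ↔ Σ (Fin k) (λ i → Fin (ρ i))
sum↔Σ zero    ρ = mk↔ₛ′ (λ ()) (λ { (() , _) }) (λ { (() , _) }) (λ ())
sum↔Σ (suc k) ρ = peel ↔-∘ ((↔-id _ ⊎-↔ sum↔Σ k (λ i → ρ (suc i))) ↔-∘ FinP.+↔⊎)
  where
  peel : (Fin (ρ zero) ⊎ Σ (Fin k) (λ i → Fin (ρ (suc i)))) ↔ Σ (Fin (suc k)) (λ i → Fin (ρ i))
  peel = mk↔ₛ′ (λ { (inj₁ r) → zero , r ; (inj₂ (i , r)) → suc i , r })
               (λ { (zero , r) → inj₁ r ; (suc i , r) → inj₂ (i , r) })
               (λ { (zero , r) → refl ; (suc i , r) → refl })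
               (λ { (inj₁ r) → refl ; (inj₂ (i , r)) → refl })

vec↔fin : ∀ {A : Set} {q} → Fin q ↔ A → ∀ n → Vec A n ↔ Fin (q ^ n)
vec↔fin enum zero    = mk↔ₛ′ (λ _ → zero) (λ _ → []) (λ { zero → refl }) (λ { [] → refl })
vec↔fin enum (suc n) = ↔-sym FinP.*↔× ↔-∘ ((↔-sym enum ×-↔ vec↔fin enum n) ↔-∘ uncons↔)
  where
  uncons↔ : Vec _ (suc n) ↔ (_ × Vec _ n)
  uncons↔ = mk↔ₛ′ Vec.uncons (λ (x , xs) → x ∷ xs) (λ _ → refl) (λ { (x ∷ xs) → refl })

toℕ-mod : ∀ {n} i → i < suc n → toℕ (i mod suc n) ≡ i
toℕ-mod i i<1+n = trans (FinP.toℕ-fromℕ< _) (m<n⇒m%n≡m i<1+n)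

mod-toℕ : ∀ {n} (j : Fin (suc n)) → toℕ j mod suc n ≡ j
mod-toℕ j = FinP.toℕ-injective (toℕ-mod (toℕ j) (FinP.toℕ<n j))

-- 12. array is an OOA

module OrthogonalArray (F : FiniteField) (t′ : ℕ) (b : Poly F (suc t′))
  (monic : b (fromℕ (suc t′)) ≡ FiniteField.1# F) (b₀≢0 : b zero ≢ FiniteField.0# F)
  (k : ℕ) (ρ : Fin k → ℕ) (a : Fin k → Stream F) (orbits : IsOrbitDecomposition F b k ρ a)
  (inv : Fin (γ F b) → Stream F → Stream F)
  (inv-spec : ∀ m → IsInvLminus F b (βof F b m) (inv m)) where
  open FieldAlgebra F
  open LinearRecurrence F b
  open MonicRecurrence F t′ b monic b₀≢0 using (t)
  open InverseShifts F b inv inv-spec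
  open Conditions F t′ b monic b₀≢0 inv inv-spec
  open ≡-Reasoning

  Rows : Set
  Rows = Row F k ρ

  array : Rows → Fin (suc (γ F b)) → Fin t → Carrier
  array = M F b k ρ a inv

  rowStream : Rows → Stream F
  rowStream (i , r) = Lpow F (toℕ r) (a i)

  rowStream-G : ∀ x → G (rowStream x)
  rowStream-G (i , r) = G-shift (toℕ r) (a i) (proj₁ orbits i)

  -- the entries of row x: ((L-β_m)^{-(j+1)} commutes with L^r)
  entry-∞ : ∀ x j → array x zero j ≡ rowStream x (ι (toℕ j))
  entry-∞ (i , r) j = cong (a i) (ℤP.+-comm (ι (toℕ r)) (ι (toℕ j)))

  entry-β : ∀ x m j →
    array x (suc m) j ≡ invPow m (suc (toℕ j)) (rowStream x) (ι 0)
  entry-β (i , r) m j = sym (invPow-shift m (suc (toℕ j)) (toℕ r) (a i) (proj₁ orbits i) (ι 0))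

  rowOf : ∀ s → G s → Rows
  rowOf s s∈G = proj₁ (proj₂ (proj₂ orbits) s s∈G)

  rowOf-≈ : ∀ s s∈G → _≈_ F s (rowStream (rowOf s s∈G))
  rowOf-≈ s s∈G = proj₁ (proj₂ (proj₂ (proj₂ orbits) s s∈G))

  rowOf-unique : ∀ s s∈G y → _≈_ F s (rowStream y) → y ≡ rowOf s s∈G
  rowOf-unique s s∈G = proj₂ (proj₂ (proj₂ (proj₂ orbits) s s∈G))

  ExactlyOneRow : (Stream F → Set) → Set
  ExactlyOneRow P = Σ Rows λ x → P (rowStream x) × (∀ y → P (rowStream y) → y ≡ x)

  unique-row : ∀ {a′ c V∞ Vβ} → UniqueSolution (Satisfies a′ c V∞ Vβ) →
    ExactlyOneRow (Satisfies a′ c V∞ Vβ)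
  unique-row sol =
      rowOf solution solution-G
    , satisfies-≈ solution _ solution-G (rowStream-G _) (rowOf-≈ solution solution-G) solves
    , λ y sat-y → rowOf-unique solution solution-G y
                    (unique solution (rowStream y) solution-G (rowStream-G y) solves sat-y)
    where open UniqueSolution sol

  -- counting: a row is determined by the first t values of its stream,
  -- and every window of t values occurs
  window : Rows → Vec Carrier t
  window x = Vec.tabulate (λ j → rowStream x (ι (toℕ j)))

  StartsWith : Vec Carrier t → Stream F → Set
  StartsWith v = Satisfies t (λ _ → 0) (λ i → Vec.lookup v (i mod t)) (λ _ _ → 0#)

  rowStartingWith : ∀ v → ExactlyOneRow (StartsWith v)
  rowStartingWith v =
    unique-row (initial-conditions (λ _ → 0) (λ i → Vec.lookup v (i mod t)) (λ _ _ → 0#) (λ _ → refl))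

  rows↔windows : Rows ↔ Vec Carrier t
  rows↔windows = mk↔ₛ′ window (λ v → proj₁ (rowStartingWith v)) window∘row row∘window
    where
    window∘row : ∀ v → window (proj₁ (rowStartingWith v)) ≡ v
    window∘row v = trans (VecP.tabulate-cong at-j) (VecP.tabulate∘lookup v)
      where
      at-j : ∀ j → rowStream (proj₁ (rowStartingWith v)) (ι (toℕ j)) ≡ Vec.lookup v j
      at-j j = trans (Satisfies.at∞ (proj₁ (proj₂ (rowStartingWith v))) (toℕ j) (FinP.toℕ<n j))
                     (cong (Vec.lookup v) (mod-toℕ j))
    row∘window : ∀ x → proj₁ (rowStartingWith (window x)) ≡ x
    row∘window x = sym (proj₂ (proj₂ (rowStartingWith (window x))) x starts)
      where
      starts : StartsWith (window x) (rowStream x)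
      starts = record
        { at∞ = λ i i<t → sym (trans (VecP.lookup∘tabulate (λ j → rowStream x (ι (toℕ j))) (i mod t))
                                     (cong (λ j → rowStream x (ι j)) (toℕ-mod i i<t)))
        ; atβ = λ m e () }

  row-count : sumℕ k ρ ≡ size ^ t
  row-count = ↔⇒≡ (vec↔fin enum t ↔-∘ (rows↔windows ↔-∘ sum↔Σ k ρ))

  -- coverage: agreeing with v on a left-justified Ω means satisfying the
  -- conditions given by the prefix lengths of Ω and the entries of v
  module Coverage (Ω : ColSet (suc (γ F b)) t) (lj : LeftJustified Ω)
                  (v : Fin (suc (γ F b)) → Fin t → Carrier) where
    a₀ : ℕ
    a₀ = count t (Ω zero)

    c : Index → ℕ
    c m = count t (Ω (suc m))

    V∞ : ℕ → Carrier
    V∞ e = v zero (e mod t)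

    Vβ : Index → ℕ → Carrier
    Vβ m e = v (suc m) (e mod t)

    Agrees : Rows → Set
    Agrees y = ∀ I j → Ω I j ≡ true → array y I j ≡ v I j

    agrees : ∀ y → Satisfies a₀ c V∞ Vβ (rowStream y) → Agrees y
    agrees y sat zero    j Ωj = begin
      array y zero j                 ≡⟨ entry-∞ y j ⟩
      rowStream y (ι (toℕ j))                  ≡⟨ Satisfies.at∞ sat (toℕ j)
                                                      (prefix-true⇒< t (Ω zero) (lj zero) j Ωj) ⟩
      v zero (toℕ j mod t)                     ≡⟨ cong (v zero) (mod-toℕ j) ⟩
      v zero j                                 ∎
    agrees y sat (suc m) j Ωj = begin
      array y (suc m) j              ≡⟨ entry-β y m j ⟩
      invPow m (suc (toℕ j)) (rowStream y) (ι 0)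
                                               ≡⟨ Satisfies.atβ sat m (toℕ j)
                                                      (prefix-true⇒< t (Ω (suc m)) (lj (suc m)) j Ωj) ⟩
      v (suc m) (toℕ j mod t)                  ≡⟨ cong (v (suc m)) (mod-toℕ j) ⟩
      v (suc m) j                              ∎

    satisfies : ∀ y → Agrees y → Satisfies a₀ c V∞ Vβ (rowStream y)
    satisfies y agree = record { at∞ = at∞ ; atβ = atβ }
      where
      column : ∀ I e → e < count t (Ω I) → toℕ (e mod t) ≡ e
      column I e e<count = toℕ-mod e (ℕP.<-≤-trans e<count (count≤ t (Ω I)))
      in-Ω : ∀ I e → e < count t (Ω I) → Ω I (e mod t) ≡ true
      in-Ω I e e<count = prefix-<⇒true t (Ω I) (lj I) (e mod t)
                           (subst (_< count t (Ω I)) (sym (column I e e<count)) e<count)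
      at∞ : ∀ e → e < a₀ → rowStream y (ι e) ≡ V∞ e
      at∞ e e<a₀ = begin
        rowStream y (ι e)                      ≡⟨ cong (λ i → rowStream y (ι i))
                                                       (sym (column zero e e<a₀)) ⟩
        rowStream y (ι (toℕ (e mod t)))        ≡⟨ sym (entry-∞ y (e mod t)) ⟩
        array y zero (e mod t)       ≡⟨ agree zero (e mod t) (in-Ω zero e e<a₀) ⟩
        V∞ e                                   ∎
      atβ : ∀ m e → e < c m → invPow m (suc e) (rowStream y) (ι 0) ≡ Vβ m e
      atβ m e e<cm = begin
        invPow m (suc e) (rowStream y) (ι 0)   ≡⟨ cong (λ i → invPow m (suc i) (rowStream y) (ι 0))
                                                       (sym (column (suc m) e e<cm)) ⟩
        invPow m (suc (toℕ (e mod t))) (rowStream y) (ι 0)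
                                               ≡⟨ sym (entry-β y m (e mod t)) ⟩
        array y (suc m) (e mod t)    ≡⟨ agree (suc m) (e mod t) (in-Ω (suc m) e e<cm) ⟩
        Vβ m e                                 ∎

  covered : ∀ Ω → LeftJustified Ω → card Ω ≡ t → Covered (array) Ω
  covered Ω lj card≡t v = proj₁ row , agrees (proj₁ row) (proj₁ (proj₂ row))
                        , λ y agree-y → proj₂ (proj₂ row) y (satisfies y agree-y)
    where
    open Coverage Ω lj v
    row : ExactlyOneRow (Satisfies a₀ c V∞ Vβ)
    row = unique-row (conditions-determine (sumℕ (γ F b) c) a₀ c refl card≡t V∞ Vβ)

-- 13. The theorem

theorem2 : (F : FiniteField) → let open FiniteField F in
    (t : ℕ) → 1 ≤ t →
    (b : Poly F t) → b (fromℕ t) ≡ 1# → b zero ≢ 0# →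
    (k : ℕ) (ρ : Fin k → ℕ) (a : Fin k → Stream F) →
    IsOrbitDecomposition F b k ρ a →
    (inv : Fin (γ F b) → Stream F → Stream F) →
    (∀ m → IsInvLminus F b (βof F b m) (inv m)) →
    IsOOA k ρ (size ^ t) t (suc (γ F b)) t (M F b k ρ a inv)
theorem2 F (suc t′) (s≤s z≤n) b monic b₀≢0 k ρ a orbits inv inv-spec = row-count , covered
  where open OrthogonalArray F t′ b monic b₀≢0 k ρ a orbits inv inv-spec
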